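{- Let $d \ge 2$ be an integer, and define polynomials $r_n, s_n \in \mathbb{Z}[b]$ by $r_0 = s_0 = 1$ and, for $n \ge 0$, \[ r_{n+1} = (b+1)\,d\, r_n s_n^{d-1}, \qquad s_{n+1} = r_n^d + (d-1) s_n^d. \] Let $n \ge 2$, and let $i, j$ be the unique integers with $n = di + j$ and $j \in \{2, 3, \dots, d+1\}$. Then \[ \deg r_n = \frac{d^{n+d-1} - d^{j-1}}{d^d - 1} - (d - j), \qquad \deg s_n = \frac{d^{n+d-1} - d^{j-1}}{d^d - 1}. \]
   Context: Here $\deg$ denotes the degree in the variable $b$. -}

module Defs where

open import Data.Nat as ℕ using (ℕ; zero; suc; _≤_; _^_; _∸_; NonZero)
open import Data.Nat.Properties using (m^n>0)
open import Data.Integer as ℤ using (ℤ; +_)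
open import Data.List using (List; []; _∷_; map; length)
open import Data.Product using (_×_; _,_; proj₁; proj₂)
open import Relation.Nullary using (yes; no)

-- Polynomials in ℤ[b], as coefficient lists (constant term first).
Poly : Set
Poly = List ℤ

infixl 6 _+P_
infixl 7 _*P_

_+P_ : Poly → Poly → Poly
[] +P q = q
(a ∷ p) +P [] = a ∷ p
(a ∷ p) +P (c ∷ q) = (a ℤ.+ c) ∷ (p +P q)

scale : ℤ → Poly → Poly
scale a = map (a ℤ.*_)

_*P_ : Poly → Poly → Poly
[] *P q = []
(a ∷ p) *P q = scale a q +P ((+ 0) ∷ (p *P q))

const : ℤ → Poly
const a = a ∷ []

X : Poly
X = (+ 0) ∷ (+ 1) ∷ []

_^P_ : Poly → ℕ → Poly
p ^P zero = const (+ 1)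
p ^P suc k = p *P (p ^P k)

strip : Poly → Poly
strip [] = []
strip (a ∷ p) with strip p
... | c ∷ q = a ∷ c ∷ q
... | [] with a ℤ.≟ + 0
...   | yes _ = []
...   | no _ = a ∷ []

-- degree in b (convention: the zero polynomial gets degree 0; irrelevant here)
deg : Poly → ℕ
deg p = length (strip p) ∸ 1

rs : ℕ → ℕ → Poly × Poly
rs d zero = const (+ 1) , const (+ 1)
rs d (suc n) =
  let r = proj₁ (rs d n)
      s = proj₂ (rs d n)
  in ((X +P const (+ 1)) *P const (+ d) *P r *P (s ^P (d ∸ 1)))
     , ((r ^P d) +P const (+ (d ∸ 1)) *P (s ^P d))

r : ℕ → ℕ → Poly
r d n = proj₁ (rs d n)

s : ℕ → ℕ → Poly
s d n = proj₂ (rs d n)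

{-# OPTIONS --safe #-}
module Submission where

open import Defs
open import Data.Nat using (ℕ; suc; _≤_; _+_; _*_; _^_; _∸_; _/_; NonZero)
open import Data.Integer as ℤ using (+_)
open import Data.Product using (_×_)
open import Relation.Binary.PropositionalEquality using (_≡_)

open import Data.Nat using (zero; _⊔_; s≤s)
open import Data.Nat.Properties
open import Data.Nat.DivMod using (m*n/n≡m)
open import Data.Nat.Tactic.RingSolver using (solve-∀)
open import Data.Integer.Properties using (pos-+; pos-*)
import Data.Integer.Tactic.RingSolver as ℤ-Solver
open import Data.List using (List; []; _∷_; map; length)
open import Data.Product using (_,_; proj₁; proj₂)
open import Relation.Binary.PropositionalEquality
  using (refl; sym; trans; cong; cong₂; subst₂; module ≡-Reasoning)

-- All coefficients of r_n and s_n are natural numbers, so no cancellation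
-- occurs: deg (p q) = deg p + deg q and deg (p + q) = max (deg p) (deg q).
-- Hence deg r_{n+1} = 1 + deg r_n + (d-1) deg s_n and
-- deg s_{n+1} = d max (deg r_n) (deg s_n).  Solving this recursion, while
-- deg r_n ≤ deg s_n the degree of s is multiplied by d and the gap
-- deg s_n - deg r_n drops by one; once deg r_n exceeds deg s_n (at j = d+1)
-- the pattern restarts, which gives deg s_{di+j} = d^{j-1} (1 + d^d + ⋯ + d^{di}).

Poly⁺ : Set
Poly⁺ = List ℕ

⌜_⌝ : Poly⁺ → Poly
⌜_⌝ = map (λ a → + a)

infixl 6 _+⁺_
infixl 7 _*⁺_

_+⁺_ : Poly⁺ → Poly⁺ → Poly⁺
[] +⁺ q = q
(a ∷ p) +⁺ [] = a ∷ p
(a ∷ p) +⁺ (c ∷ q) = (a + c) ∷ (p +⁺ q)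

scale⁺ : ℕ → Poly⁺ → Poly⁺
scale⁺ a = map (a *_)

_*⁺_ : Poly⁺ → Poly⁺ → Poly⁺
[] *⁺ q = []
(a ∷ p) *⁺ q = scale⁺ a q +⁺ (0 ∷ (p *⁺ q))

_^⁺_ : Poly⁺ → ℕ → Poly⁺
p ^⁺ zero = 1 ∷ []
p ^⁺ suc k = p *⁺ (p ^⁺ k)

⌜⌝-+ : ∀ p q → ⌜ p +⁺ q ⌝ ≡ ⌜ p ⌝ +P ⌜ q ⌝
⌜⌝-+ [] q = refl
⌜⌝-+ (a ∷ p) [] = refl
⌜⌝-+ (a ∷ p) (c ∷ q) = cong (+ (a + c) ∷_) (⌜⌝-+ p q)

⌜⌝-scale : ∀ a q → ⌜ scale⁺ a q ⌝ ≡ scale (+ a) ⌜ q ⌝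
⌜⌝-scale a [] = refl
⌜⌝-scale a (c ∷ q) = cong₂ _∷_ (pos-* a c) (⌜⌝-scale a q)

⌜⌝-* : ∀ p q → ⌜ p *⁺ q ⌝ ≡ ⌜ p ⌝ *P ⌜ q ⌝
⌜⌝-* [] q = refl
⌜⌝-* (a ∷ p) q = trans (⌜⌝-+ (scale⁺ a q) (0 ∷ (p *⁺ q)))
  (cong₂ _+P_ (⌜⌝-scale a q) (cong (+ 0 ∷_) (⌜⌝-* p q)))

⌜⌝-^ : ∀ p k → ⌜ p ^⁺ k ⌝ ≡ ⌜ p ⌝ ^P k
⌜⌝-^ p zero = refl
⌜⌝-^ p (suc k) = trans (⌜⌝-* p (p ^⁺ k)) (cong (⌜ p ⌝ *P_) (⌜⌝-^ p k))

size : Poly⁺ → ℕ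
size p = length (strip ⌜ p ⌝)

consSize : ℕ → ℕ → ℕ
consSize a (suc k) = suc (suc k)
consSize zero zero = 0
consSize (suc _) zero = 1

scaleSize : ℕ → ℕ → ℕ
scaleSize zero y = 0
scaleSize (suc _) y = y

productSize : ℕ → ℕ → ℕ
productSize zero y = 0
productSize (suc x) zero = 0
productSize (suc x) (suc y) = suc (x + y)

size-∷ : ∀ a p → size (a ∷ p) ≡ consSize a (size p)
size-∷ a p with strip ⌜ p ⌝
... | c ∷ q = refl
... | [] with a
...   | zero = refl
...   | suc _ = refl

consSize-+-⊔ : ∀ a c x y → consSize (a + c) (x ⊔ y) ≡ consSize a x ⊔ consSize c y
consSize-+-⊔ a c (suc x) (suc y) = refl
consSize-+-⊔ a zero (suc x) zero = refl
consSize-+-⊔ a (suc c) (suc x) zero = refl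
consSize-+-⊔ zero c zero (suc y) = refl
consSize-+-⊔ (suc a) c zero (suc y) = refl
consSize-+-⊔ zero zero zero zero = refl
consSize-+-⊔ zero (suc c) zero zero = refl
consSize-+-⊔ (suc a) zero zero zero = refl
consSize-+-⊔ (suc a) (suc c) zero zero = refl

size-+⁺ : ∀ p q → size (p +⁺ q) ≡ size p ⊔ size q
size-+⁺ [] q = refl
size-+⁺ (a ∷ p) [] = sym (⊔-identityʳ _)
size-+⁺ (a ∷ p) (c ∷ q) = begin
  size ((a + c) ∷ (p +⁺ q))              ≡⟨ size-∷ (a + c) (p +⁺ q) ⟩
  consSize (a + c) (size (p +⁺ q))       ≡⟨ cong (consSize (a + c)) (size-+⁺ p q) ⟩
  consSize (a + c) (size p ⊔ size q)     ≡⟨ consSize-+-⊔ a c (size p) (size q) ⟩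
  consSize a (size p) ⊔ consSize c (size q)
    ≡⟨ sym (cong₂ _⊔_ (size-∷ a p) (size-∷ c q)) ⟩
  size (a ∷ p) ⊔ size (c ∷ q)            ∎
  where open ≡-Reasoning

size-scale-zero : ∀ q → size (scale⁺ 0 q) ≡ 0
size-scale-zero [] = refl
size-scale-zero (c ∷ q) = trans (size-∷ 0 (scale⁺ 0 q)) (cong (consSize 0) (size-scale-zero q))

consSize-* : ∀ a c x → consSize (suc a * c) x ≡ consSize c x
consSize-* a c (suc x) = refl
consSize-* a zero zero rewrite *-zeroʳ a = refl
consSize-* a (suc c) zero = refl

size-scale-suc : ∀ a q → size (scale⁺ (suc a) q) ≡ size q
size-scale-suc a [] = refl
size-scale-suc a (c ∷ q) = begin
  size (scale⁺ (suc a) (c ∷ q))                    ≡⟨ size-∷ (suc a * c) (scale⁺ (suc a) q) ⟩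
  consSize (suc a * c) (size (scale⁺ (suc a) q))   ≡⟨ cong (consSize (suc a * c)) (size-scale-suc a q) ⟩
  consSize (suc a * c) (size q)                    ≡⟨ consSize-* a c (size q) ⟩
  consSize c (size q)                              ≡⟨ sym (size-∷ c q) ⟩
  size (c ∷ q)                                     ∎
  where open ≡-Reasoning

size-scale : ∀ a q → size (scale⁺ a q) ≡ scaleSize a (size q)
size-scale zero q = size-scale-zero q
size-scale (suc a) q = size-scale-suc a q

productSize-consSize : ∀ a x y →
  scaleSize a y ⊔ consSize 0 (productSize x y) ≡ productSize (consSize a x) y
productSize-consSize zero zero zero = refl
productSize-consSize zero zero (suc y) = refl
productSize-consSize (suc a) zero zero = refl
productSize-consSize (suc a) zero (suc y) = refl
productSize-consSize zero (suc x) zero = refl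
productSize-consSize (suc a) (suc x) zero = refl
productSize-consSize zero (suc x) (suc y) = refl
productSize-consSize (suc a) (suc x) (suc y) =
  m≤n⇒m⊔n≡n (s≤s (≤-trans (m≤n+m y x) (n≤1+n _)))

size-*⁺ : ∀ p q → size (p *⁺ q) ≡ productSize (size p) (size q)
size-*⁺ [] q = refl
size-*⁺ (a ∷ p) q = begin
  size (scale⁺ a q +⁺ (0 ∷ (p *⁺ q)))
    ≡⟨ size-+⁺ (scale⁺ a q) (0 ∷ (p *⁺ q)) ⟩
  size (scale⁺ a q) ⊔ size (0 ∷ (p *⁺ q))
    ≡⟨ cong₂ _⊔_ (size-scale a q) (size-∷ 0 (p *⁺ q)) ⟩
  scaleSize a (size q) ⊔ consSize 0 (size (p *⁺ q))
    ≡⟨ cong (λ z → scaleSize a (size q) ⊔ consSize 0 z) (size-*⁺ p q) ⟩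
  scaleSize a (size q) ⊔ consSize 0 (productSize (size p) (size q))
    ≡⟨ productSize-consSize a (size p) (size q) ⟩
  productSize (consSize a (size p)) (size q)
    ≡⟨ cong (λ z → productSize z (size q)) (sym (size-∷ a p)) ⟩
  productSize (size (a ∷ p)) (size q)
    ∎
  where open ≡-Reasoning

size-*⁺-suc : ∀ p q {m k} → size p ≡ suc m → size q ≡ suc k → size (p *⁺ q) ≡ suc (m + k)
size-*⁺-suc p q p≡ q≡ = trans (size-*⁺ p q) (cong₂ productSize p≡ q≡)

size-^⁺ : ∀ p k {m} → size p ≡ suc m → size (p ^⁺ k) ≡ suc (k * m)
size-^⁺ p zero p≡ = refl
size-^⁺ p (suc k) p≡ = size-*⁺-suc p (p ^⁺ k) p≡ (size-^⁺ p k p≡)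

r⁺ s⁺ : ℕ → ℕ → Poly⁺
r⁺ d zero = 1 ∷ []
r⁺ d (suc n) = (1 ∷ 1 ∷ []) *⁺ (d ∷ []) *⁺ r⁺ d n *⁺ (s⁺ d n ^⁺ (d ∸ 1))
s⁺ d zero = 1 ∷ []
s⁺ d (suc n) = (r⁺ d n ^⁺ d) +⁺ ((d ∸ 1) ∷ []) *⁺ (s⁺ d n ^⁺ d)

⌜rs⁺⌝ : ∀ d n → r d n ≡ ⌜ r⁺ d n ⌝ × s d n ≡ ⌜ s⁺ d n ⌝
⌜rs⁺⌝ d zero = refl , refl
⌜rs⁺⌝ d (suc n) with ⌜rs⁺⌝ d n
... | r≡ , s≡ =
  trans (cong₂ (λ u v → (X +P const (+ 1)) *P const (+ d) *P u *P (v ^P (d ∸ 1))) r≡ s≡)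
        (sym (trans (⌜⌝-* (b+1 *⁺ c *⁺ u) (v ^⁺ (d ∸ 1)))
                    (cong₂ _*P_ (trans (⌜⌝-* (b+1 *⁺ c) u) (cong (_*P ⌜ u ⌝) (⌜⌝-* b+1 c)))
                                (⌜⌝-^ v (d ∸ 1))))) ,
  trans (cong₂ (λ u v → (u ^P d) +P const (+ (d ∸ 1)) *P (v ^P d)) r≡ s≡)
        (sym (trans (⌜⌝-+ (u ^⁺ d) (c′ *⁺ (v ^⁺ d)))
                    (cong₂ _+P_ (⌜⌝-^ u d)
                                (trans (⌜⌝-* c′ (v ^⁺ d)) (cong (const (+ (d ∸ 1)) *P_) (⌜⌝-^ v d))))))
  where
  u v b+1 c c′ : Poly⁺
  u = r⁺ d n
  v = s⁺ d n
  b+1 = 1 ∷ 1 ∷ []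
  c = d ∷ []
  c′ = (d ∸ 1) ∷ []

degR degS : ℕ → ℕ → ℕ
degR d zero = 0
degR d (suc n) = suc (degR d n + (d ∸ 1) * degS d n)
degS d zero = 0
degS d (suc n) = d * degR d n ⊔ d * degS d n

-- The hypothesis d ≥ 2 makes the scalars d and d - 1 in the recursion nonzero.
size-rs⁺ : ∀ e n → let d = suc (suc e) in
  size (r⁺ d n) ≡ suc (degR d n) × size (s⁺ d n) ≡ suc (degS d n)
size-rs⁺ e zero = refl , refl
size-rs⁺ e (suc n) with size-rs⁺ e n
... | r≡ , s≡ =
  size-*⁺-suc (b+1 *⁺ c *⁺ u) (v ^⁺ suc e)
    (size-*⁺-suc (b+1 *⁺ c) u (size-*⁺-suc b+1 c refl refl) r≡) (size-^⁺ v (suc e) s≡) ,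
  trans (size-+⁺ (u ^⁺ d) (c′ *⁺ (v ^⁺ d)))
        (cong₂ _⊔_ (size-^⁺ u d r≡) (size-*⁺-suc c′ (v ^⁺ d) refl (size-^⁺ v d s≡)))
  where
  d : ℕ
  d = suc (suc e)
  u v b+1 c c′ : Poly⁺
  u = r⁺ d n
  v = s⁺ d n
  b+1 = 1 ∷ 1 ∷ []
  c = d ∷ []
  c′ = suc e ∷ []

deg-rs : ∀ e n → let d = suc (suc e) in deg (r d n) ≡ degR d n × deg (s d n) ≡ degS d n
deg-rs e n with ⌜rs⁺⌝ (suc (suc e)) n | size-rs⁺ e n
... | r≡ , s≡ | rsize , ssize = trans (cong deg r≡) (cong (_∸ 1) rsize) , trans (cong deg s≡) (cong (_∸ 1) ssize)

-- deg s_n = b and deg r_n = b - (d - j), with the subtraction moved across.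
Degrees : ℕ → ℕ → ℕ → ℕ → Set
Degrees d n b j = degS d n ≡ b × degR d n + d ≡ b + j

degrees-suc : ∀ {d n b j} → Degrees (suc d) n b j → j ≤ suc d →
              Degrees (suc d) (suc n) (suc d * b) (suc j)
degrees-suc {d} {n} {j = j} (refl , gap) j≤ = degS-suc , (begin
  suc (a + d * b) + suc d  ≡⟨ regroup a b d ⟩
  suc (a + suc d + d * b)  ≡⟨ cong (λ x → suc (x + d * b)) gap ⟩
  suc (b + j + d * b)      ≡⟨ collect b d j ⟩
  suc d * b + suc j        ∎)
  where
  open ≡-Reasoning
  regroup : ∀ a b d → suc (a + d * b) + suc d ≡ suc (a + suc d + d * b)
  regroup = solve-∀
  collect : ∀ b d j → suc (b + j + d * b) ≡ suc d * b + suc j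
  collect = solve-∀
  a b : ℕ
  a = degR (suc d) n
  b = degS (suc d) n
  a≤b : a ≤ b
  a≤b = +-cancelʳ-≤ (suc d) a b (subst₂ _≤_ (sym gap) refl (+-monoʳ-≤ b j≤))
  degS-suc : suc d * a ⊔ suc d * b ≡ suc d * b
  degS-suc = m≤n⇒m⊔n≡n (*-monoʳ-≤ (suc d) a≤b)

degrees-wrap : ∀ {d n b} → Degrees (suc d) n b (suc (suc d)) →
               Degrees (suc d) (suc n) (suc d * suc b) 2
degrees-wrap {d} {n} (refl , gap) =
  trans (cong (λ x → suc d * x ⊔ suc d * b) a≡1+b) (m≥n⇒m⊔n≡m (*-monoʳ-≤ (suc d) (n≤1+n b))) ,
  trans (cong (λ x → suc (x + d * b) + suc d) a≡1+b) (collect b d)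
  where
  b : ℕ
  b = degS (suc d) n
  a≡1+b : degR (suc d) n ≡ suc b
  a≡1+b = +-cancelʳ-≡ (suc d) (degR (suc d) n) (suc b) (trans gap (+-suc b (suc d)))
  collect : ∀ b d → suc (suc b + d * b) + suc d ≡ suc d * suc b + 2
  collect = solve-∀

geom : ℕ → ℕ → ℕ
geom D zero = 1
geom D (suc i) = suc (D * geom D i)

-- j = k + 2 runs through 2 … d + 1.  The first block is reached from n = 1, which
-- is the state j = d + 1 of a fictitious block i = -1.
degrees-at : ∀ c i k → k ≤ c → let d = suc c in
  Degrees d (d * i + suc (suc k)) (d ^ suc k * geom (d ^ d) i) (suc (suc k))
degrees-at c zero zero _ =
  subst₂ (λ n b → Degrees (suc c) n b 2) (cong (_+ 2) (sym (*-zeroʳ (suc c)))) (first-value c)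
    (degrees-wrap (degrees-suc {d = c} {n = 0} (refl , refl) ≤-refl))
  where
  first-value : ∀ c → suc c * suc (suc c * 0) ≡ suc c * 1 * 1
  first-value = solve-∀
degrees-at c (suc i) zero _ =
  subst₂ (λ n b → Degrees (suc c) n b 2) (wrap-index c i)
    (cong (_* geom (suc c ^ suc c) (suc i)) (sym (*-identityʳ (suc c))))
    (degrees-wrap (degrees-at c i c ≤-refl))
  where
  wrap-index : ∀ c i → suc (suc c * i + suc (suc c)) ≡ suc c * suc i + 2
  wrap-index = solve-∀
degrees-at c i (suc k) k<c =
  subst₂ (λ n b → Degrees (suc c) n b (suc (suc (suc k))))
    (sym (+-suc (suc c * i) (suc (suc k))))
    (sym (*-assoc (suc c) (suc c ^ suc k) (geom (suc c ^ suc c) i)))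
    (degrees-suc (degrees-at c i k (<⇒≤ k<c)) (s≤s k<c))

geom-closed : ∀ D i → D * geom (suc D) i + 1 ≡ suc D ^ suc i
geom-closed D zero = D*1+1≡[1+D]*1 D
  where
  D*1+1≡[1+D]*1 : ∀ D → D * 1 + 1 ≡ suc D * 1
  D*1+1≡[1+D]*1 = solve-∀
geom-closed D (suc i) = trans (horner D (geom (suc D) i)) (cong (suc D *_) (geom-closed D i))
  where
  horner : ∀ D g → D * suc (suc D * g) + 1 ≡ suc D * (D * g + 1)
  horner = solve-∀

geom-quotient : ∀ {D} p i → 1 ≤ D → .{{_ : NonZero (D ∸ 1)}} →
                (p * D ^ suc i ∸ p) / (D ∸ 1) ≡ p * geom D i
geom-quotient {suc D} p i _ = begin
  (p * suc D ^ suc i ∸ p) / D        ≡⟨ cong (λ x → (p * x ∸ p) / D) (sym (geom-closed D i)) ⟩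
  (p * (D * g + 1) ∸ p) / D          ≡⟨ cong (λ x → (x ∸ p) / D) (expand p D g) ⟩
  ((p * g) * D + p ∸ p) / D          ≡⟨ cong (_/ D) (m+n∸n≡m ((p * g) * D) p) ⟩
  (p * g) * D / D                    ≡⟨ m*n/n≡m (p * g) D ⟩
  p * g                              ∎
  where
  open ≡-Reasoning
  g : ℕ
  g = geom (suc D) i
  expand : ∀ p D g → p * (D * g + 1) ≡ (p * g) * D + p
  expand = solve-∀

pow-index : ∀ d i k → d ^ (d * i + suc (suc k) + d ∸ 1) ≡ d ^ suc k * (d ^ d) ^ suc i
pow-index d i k = begin
  d ^ (d * i + suc (suc k) + d ∸ 1)   ≡⟨ cong (λ x → d ^ (x ∸ 1)) (regroup d i k) ⟩
  d ^ (suc k + d * suc i)             ≡⟨ ^-distribˡ-+-* d (suc k) (d * suc i) ⟩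
  d ^ suc k * d ^ (d * suc i)         ≡⟨ cong (d ^ suc k *_) (sym (^-*-assoc d d (suc i))) ⟩
  d ^ suc k * (d ^ d) ^ suc i         ∎
  where
  open ≡-Reasoning
  regroup : ∀ d i k → d * i + suc (suc k) + d ≡ suc (suc k + d * suc i)
  regroup = solve-∀

+a≡+b-[+c-+j] : ∀ a b c j → a + c ≡ b + j → + a ≡ + b ℤ.- (+ c ℤ.- + j)
+a≡+b-[+c-+j] a b c j a+c≡b+j = begin
  + a                          ≡⟨ add-sub (+ a) (+ c) ⟩
  + a ℤ.+ + c ℤ.- + c          ≡⟨ cong (ℤ._- + c) (sym (pos-+ a c)) ⟩
  + (a + c) ℤ.- + c            ≡⟨ cong (λ x → + x ℤ.- + c) a+c≡b+j ⟩
  + (b + j) ℤ.- + c            ≡⟨ cong (ℤ._- + c) (pos-+ b j) ⟩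
  + b ℤ.+ + j ℤ.- + c          ≡⟨ sub-sub (+ b) (+ c) (+ j) ⟩
  + b ℤ.- (+ c ℤ.- + j)        ∎
  where
  open ≡-Reasoning
  add-sub : ∀ x y → x ≡ x ℤ.+ y ℤ.- y
  add-sub = ℤ-Solver.solve-∀
  sub-sub : ∀ x y z → x ℤ.+ z ℤ.- y ≡ x ℤ.- (y ℤ.- z)
  sub-sub = ℤ-Solver.solve-∀

proposition2p1 : (d : ℕ) → 2 ≤ d → .{{_ : NonZero (d ^ d ∸ 1)}}
    → (n i j : ℕ) → 2 ≤ n → 2 ≤ j → j ≤ suc d → n ≡ d * i + j
    → ((+ deg (r d n)) ≡ (+ ((d ^ (n + d ∸ 1) ∸ d ^ (j ∸ 1)) / (d ^ d ∸ 1))) ℤ.- ((+ d) ℤ.- (+ j)))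
      × (deg (s d n) ≡ (d ^ (n + d ∸ 1) ∸ d ^ (j ∸ 1)) / (d ^ d ∸ 1))
proposition2p1 (suc (suc e)) _ .(suc (suc e) * i + suc (suc k)) i (suc (suc k)) _ (s≤s (s≤s _)) (s≤s (s≤s k≤)) refl =
  trans (cong +_ degR≡)
        (+a≡+b-[+c-+j] (degR d n) _ d (suc (suc k)) (trans gap (cong (_+ suc (suc k)) (sym closed-form)))) ,
  trans degS≡ (trans degS≡value (sym closed-form))
  where
  d n : ℕ
  d = suc (suc e)
  n = d * i + suc (suc k)
  closed-form : (d ^ (n + d ∸ 1) ∸ d ^ suc k) / (d ^ d ∸ 1) ≡ d ^ suc k * geom (d ^ d) i
  closed-form = trans (cong (λ x → (x ∸ d ^ suc k) / (d ^ d ∸ 1)) (pow-index d i k))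
                      (geom-quotient (d ^ suc k) i (m^n>0 d d))
  degR≡ : deg (r d n) ≡ degR d n
  degR≡ = proj₁ (deg-rs e n)
  degS≡ : deg (s d n) ≡ degS d n
  degS≡ = proj₂ (deg-rs e n)
  degS≡value : degS d n ≡ d ^ suc k * geom (d ^ d) i
  degS≡value = proj₁ (degrees-at (suc e) i k k≤)
  gap : degR d n + d ≡ d ^ suc k * geom (d ^ d) i + suc (suc k)
  gap = proj₂ (degrees-at (suc e) i k k≤)
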